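{- Let $m,n,m',n',r,s$ be positive integers with $m'r$ even. Suppose there exists a shiftable $SMR(m,n;r,s)$ and there exists an $SMR(m',n';r,s)$. Then for every integer $k\geq 1$ there exists an $SMR(km+m',kn+n';r,s)$; moreover, if the given $SMR(m',n';r,s)$ is shiftable, then there exists a shiftable $SMR(km+m',kn+n';r,s)$.
   Context: A signed magic rectangle $SMR(m,n;r,s)$ is an $m\times n$ array, some of whose cells are filled with integers and the others empty, such that exactly $r$ cells in every row and exactly $s$ cells in every column are filled (so $mr=ns$), every element of a set $X$ appears exactly once in the array, and the sum of the entries of each row and of each column is zero. Here $X=\{\pm1,\pm2,\ldots,\pm mr/2\}$ if $mr$ is even, and $X=\{0,\pm1,\ldots,\pm (mr-1)/2\}$ if $mr$ is odd. An array is shiftable if every row and every column contains the same number of positive entries as negative entries. -}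

module Defs where

open import Data.Nat as ℕ using (ℕ; zero; suc; _/_; _%_)
open import Data.Integer as ℤ using (ℤ; ∣_∣; 0ℤ; +_)
import Data.Integer.Properties as ℤP
open import Data.Fin using (Fin; zero; suc)
open import Data.Maybe using (Maybe; just; nothing)
import Data.Maybe.Properties as MaybeP
open import Data.Product using (_×_)
open import Relation.Binary.PropositionalEquality using (_≡_; _≢_)
open import Relation.Nullary.Decidable using (isYes)
open import Data.Bool using (if_then_else_)

-- A partially filled m × n array of integers: nothing = empty cell.
Array : ℕ → ℕ → Set
Array m n = Fin m → Fin n → Maybe ℤ

sumℕ : (k : ℕ) → (Fin k → ℕ) → ℕ
sumℕ zero    f = 0
sumℕ (suc k) f = f zero ℕ.+ sumℕ k (λ i → f (suc i))

sumℤ : (k : ℕ) → (Fin k → ℤ) → ℤ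
sumℤ zero    f = 0ℤ
sumℤ (suc k) f = f zero ℤ.+ sumℤ k (λ i → f (suc i))

filled : Maybe ℤ → ℕ
filled (just _) = 1
filled nothing  = 0

val : Maybe ℤ → ℤ
val (just x) = x
val nothing  = 0ℤ

posE : Maybe ℤ → ℕ
posE (just x) = if isYes (ℤ.+ 1 ℤ.≤? x) then 1 else 0
posE nothing  = 0

negE : Maybe ℤ → ℕ
negE (just x) = if isYes (x ℤ.≤? ℤ.- (ℤ.+ 1)) then 1 else 0
negE nothing  = 0

isVal : ℤ → Maybe ℤ → ℕ
isVal x c = if isYes (MaybeP.≡-dec ℤP._≟_ c (just x)) then 1 else 0

-- The set X for N = m r cells:
--   N even: {±1, …, ±N/2};   N odd: {0, ±1, …, ±(N-1)/2}.
InX : ℕ → ℤ → Set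
InX N x = (N % 2 ≡ 0 → x ≢ 0ℤ) × (∣ x ∣ ℕ.≤ N / 2)

record SMR (m n r s : ℕ) : Set where
  field
    A          : Array m n
    rowFilled  : ∀ i → sumℕ n (λ j → filled (A i j)) ≡ r
    colFilled  : ∀ j → sumℕ m (λ i → filled (A i j)) ≡ s
    entriesInX : ∀ i j x → A i j ≡ just x → InX (m ℕ.* r) x
    eachOnce   : ∀ x → InX (m ℕ.* r) x →
                 sumℕ m (λ i → sumℕ n (λ j → isVal x (A i j))) ≡ 1
    rowSum     : ∀ i → sumℤ n (λ j → val (A i j)) ≡ 0ℤ
    colSum     : ∀ j → sumℤ m (λ i → val (A i j)) ≡ 0ℤ

Shiftable : ∀ {m n r s} → SMR m n r s → Set
Shiftable {m} {n} S =
  (∀ i → sumℕ n (λ j → posE (A i j)) ≡ sumℕ n (λ j → negE (A i j))) ×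
  (∀ j → sumℕ m (λ i → posE (A i j)) ≡ sumℕ m (λ i → negE (A i j)))
  where open SMR S

-- Let A be a shiftable SMR(m,n;r,s) with m r = 2a. Shifting every entry of A away from zero by c
-- (x ↦ x + c for x > 0, x ↦ x − c for x < 0) changes each line sum by c·(#positive − #negative) = 0
-- and carries {±1,…,±a} onto {±(c+1),…,±(c+a)}. So for an SMR(M,N;r,s) C with M r = 2c, the
-- block-diagonal array of C and the shifted A is an SMR(M+m,N+n;r,s), shiftable when C is; adding
-- k shifted copies of A to B proves the theorem.
-- The hypotheses force m r to be even: otherwise r is odd and 0 is an entry of A, so every row of A
-- (balanced between positive and negative entries) must contain the unique 0. Then m = 1, hence
-- s = 1, and a column of B would sum to its single entry, which is nonzero since m′ r is even.
module Submission where

open import Defs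
open import Algebra.Bundles using (AbelianGroup)
open import Data.Fin using (Fin; zero; suc; _↑ˡ_; _↑ʳ_; splitAt; fromℕ<)
open import Data.Fin.Properties using (splitAt-↑ˡ; splitAt-↑ʳ; splitAt⁻¹-↑ˡ; splitAt⁻¹-↑ʳ)
open import Data.Integer as ℤ using (ℤ; 0ℤ; +_; -[1+_]; ∣_∣)
import Data.Integer.Properties as ℤₚ
open import Data.Maybe using (Maybe; just; nothing; map)
import Data.Maybe.Properties as Maybeₚ
open import Data.Nat using (ℕ; zero; suc; _+_; _*_; _∸_; _≤_; _<_; z≤n; s≤s)
import Data.Nat.Properties as ℕₚ
open import Data.Nat.Divisibility
  using (_∣_; _∣?_; divides; quotient; ∣m∣n⇒∣m+n; ∣n⇒∣m*n; m%n≡0⇒n∣m; n∣m⇒m%n≡0)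
open import Data.Nat.DivMod using (m*n%n≡0; m*n/n≡m)
open import Data.Product using (Σ; _×_; _,_; proj₁; proj₂)
open import Data.Sum using (_⊎_; inj₁; inj₂)
open import Function using (_∘_; id)
open import Relation.Nullary using (¬_; yes; no; contradiction)
open import Relation.Binary.PropositionalEquality

open import Algebra.Properties.Group (AbelianGroup.group ℤₚ.+-0-abelianGroup) using (∙-cancelʳ)
open import Algebra.Properties.CommutativeSemigroup ℕₚ.+-commutativeSemigroup
  using () renaming (interchange to ℕ-interchange)
open import Algebra.Properties.CommutativeSemigroup ℤₚ.+-commutativeSemigroup
  using () renaming (interchange to ℤ-interchange)

sumℕ-cong : ∀ k {f g : Fin k → ℕ} → (∀ i → f i ≡ g i) → sumℕ k f ≡ sumℕ k g
sumℕ-cong zero    f≗g = refl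
sumℕ-cong (suc k) f≗g = cong₂ _+_ (f≗g zero) (sumℕ-cong k (f≗g ∘ suc))

sumℤ-cong : ∀ k {f g : Fin k → ℤ} → (∀ i → f i ≡ g i) → sumℤ k f ≡ sumℤ k g
sumℤ-cong zero    f≗g = refl
sumℤ-cong (suc k) f≗g = cong₂ ℤ._+_ (f≗g zero) (sumℤ-cong k (f≗g ∘ suc))

sumℕ-zero : ∀ k {f : Fin k → ℕ} → (∀ i → f i ≡ 0) → sumℕ k f ≡ 0
sumℕ-zero zero    f≗0 = refl
sumℕ-zero (suc k) f≗0 = cong₂ _+_ (f≗0 zero) (sumℕ-zero k (f≗0 ∘ suc))

sumℤ-zero : ∀ k {f : Fin k → ℤ} → (∀ i → f i ≡ 0ℤ) → sumℤ k f ≡ 0ℤ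
sumℤ-zero zero    f≗0 = refl
sumℤ-zero (suc k) f≗0 = cong₂ ℤ._+_ (f≗0 zero) (sumℤ-zero k (f≗0 ∘ suc))

sumℕ-++ : ∀ a b (f : Fin (a + b) → ℕ) →
          sumℕ (a + b) f ≡ sumℕ a (λ i → f (i ↑ˡ b)) + sumℕ b (λ i → f (a ↑ʳ i))
sumℕ-++ zero    b f = refl
sumℕ-++ (suc a) b f =
  trans (cong (_+_ (f zero)) (sumℕ-++ a b (f ∘ suc))) (sym (ℕₚ.+-assoc (f zero) _ _))

sumℤ-++ : ∀ a b (f : Fin (a + b) → ℤ) →
          sumℤ (a + b) f ≡ sumℤ a (λ i → f (i ↑ˡ b)) ℤ.+ sumℤ b (λ i → f (a ↑ʳ i))
sumℤ-++ zero    b f = sym (ℤₚ.+-identityˡ _)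
sumℤ-++ (suc a) b f =
  trans (cong (ℤ._+_ (f zero)) (sumℤ-++ a b (f ∘ suc))) (sym (ℤₚ.+-assoc (f zero) _ _))

sumℕ-↑ˡ : ∀ a b (f : Fin (a + b) → ℕ) → (∀ i → f (a ↑ʳ i) ≡ 0) →
          sumℕ (a + b) f ≡ sumℕ a (λ i → f (i ↑ˡ b))
sumℕ-↑ˡ a b f f≗0 = begin
  sumℕ (a + b) f  ≡⟨ sumℕ-++ a b f ⟩
  left + right    ≡⟨ cong (_+_ left) (sumℕ-zero b f≗0) ⟩
  left + 0        ≡⟨ ℕₚ.+-identityʳ left ⟩
  left            ∎
  where
  open ≡-Reasoning
  left right : ℕ
  left  = sumℕ a (λ i → f (i ↑ˡ b))
  right = sumℕ b (λ i → f (a ↑ʳ i))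

sumℕ-↑ʳ : ∀ a b (f : Fin (a + b) → ℕ) → (∀ i → f (i ↑ˡ b) ≡ 0) →
          sumℕ (a + b) f ≡ sumℕ b (λ i → f (a ↑ʳ i))
sumℕ-↑ʳ a b f f≗0 = trans (sumℕ-++ a b f) (cong (_+ sumℕ b (λ i → f (a ↑ʳ i))) (sumℕ-zero a f≗0))

sumℤ-↑ˡ : ∀ a b (f : Fin (a + b) → ℤ) → (∀ i → f (a ↑ʳ i) ≡ 0ℤ) →
          sumℤ (a + b) f ≡ sumℤ a (λ i → f (i ↑ˡ b))
sumℤ-↑ˡ a b f f≗0 = begin
  sumℤ (a + b) f    ≡⟨ sumℤ-++ a b f ⟩
  left ℤ.+ right    ≡⟨ cong (ℤ._+_ left) (sumℤ-zero b f≗0) ⟩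
  left ℤ.+ 0ℤ       ≡⟨ ℤₚ.+-identityʳ left ⟩
  left              ∎
  where
  open ≡-Reasoning
  left right : ℤ
  left  = sumℤ a (λ i → f (i ↑ˡ b))
  right = sumℤ b (λ i → f (a ↑ʳ i))

sumℤ-↑ʳ : ∀ a b (f : Fin (a + b) → ℤ) → (∀ i → f (i ↑ˡ b) ≡ 0ℤ) →
          sumℤ (a + b) f ≡ sumℤ b (λ i → f (a ↑ʳ i))
sumℤ-↑ʳ a b f f≗0 = begin
  sumℤ (a + b) f    ≡⟨ sumℤ-++ a b f ⟩
  left ℤ.+ right    ≡⟨ cong (ℤ._+ right) (sumℤ-zero a f≗0) ⟩
  0ℤ ℤ.+ right      ≡⟨ ℤₚ.+-identityˡ right ⟩
  right             ∎
  where
  open ≡-Reasoning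
  left right : ℤ
  left  = sumℤ a (λ i → f (i ↑ˡ b))
  right = sumℤ b (λ i → f (a ↑ʳ i))

sumℕ-distrib-+ : ∀ k (f g : Fin k → ℕ) → sumℕ k (λ i → f i + g i) ≡ sumℕ k f + sumℕ k g
sumℕ-distrib-+ zero    f g = refl
sumℕ-distrib-+ (suc k) f g =
  trans (cong (_+_ (f zero + g zero)) (sumℕ-distrib-+ k (f ∘ suc) (g ∘ suc)))
        (ℕ-interchange (f zero) (g zero) _ _)

sumℤ-distrib-+ : ∀ k (f g : Fin k → ℤ) → sumℤ k (λ i → f i ℤ.+ g i) ≡ sumℤ k f ℤ.+ sumℤ k g
sumℤ-distrib-+ zero    f g = refl
sumℤ-distrib-+ (suc k) f g =
  trans (cong (ℤ._+_ (f zero ℤ.+ g zero)) (sumℤ-distrib-+ k (f ∘ suc) (g ∘ suc)))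
        (ℤ-interchange (f zero) (g zero) _ _)

sumℤ-+ : ∀ k (f : Fin k → ℕ) → sumℤ k (λ i → + f i) ≡ + sumℕ k f
sumℤ-+ zero    f = refl
sumℤ-+ (suc k) f = cong (ℤ._+_ (+ f zero)) (sumℤ-+ k (f ∘ suc))

*-distribʳ-sumℕ : ∀ k c (f : Fin k → ℕ) → sumℕ k f * c ≡ sumℕ k (λ i → f i * c)
*-distribʳ-sumℕ zero    c f = refl
*-distribʳ-sumℕ (suc k) c f =
  trans (ℕₚ.*-distribʳ-+ c (f zero) _) (cong (_+_ (f zero * c)) (*-distribʳ-sumℕ k c (f ∘ suc)))

sumℕ≤length : ∀ k (f : Fin k → ℕ) → (∀ i → f i ≤ 1) → sumℕ k f ≤ k
sumℕ≤length zero    f f≤1 = z≤n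
sumℕ≤length (suc k) f f≤1 = ℕₚ.+-mono-≤ (f≤1 zero) (sumℕ≤length k (f ∘ suc) (f≤1 ∘ suc))

length≤sumℕ : ∀ k (f : Fin k → ℕ) → (∀ i → 1 ≤ f i) → k ≤ sumℕ k f
length≤sumℕ zero    f 1≤f = z≤n
length≤sumℕ (suc k) f 1≤f = ℕₚ.+-mono-≤ (1≤f zero) (length≤sumℕ k (f ∘ suc) (1≤f ∘ suc))

↑-elim : ∀ {a b} (P : Fin (a + b) → Set) →
         (∀ i → P (i ↑ˡ b)) → (∀ i → P (a ↑ʳ i)) → ∀ i → P i
↑-elim {a} {b} P Pˡ Pʳ i with splitAt a {b} i in eq
... | inj₁ i′ = subst P (splitAt⁻¹-↑ˡ eq) (Pˡ i′)
... | inj₂ i′ = subst P (splitAt⁻¹-↑ʳ eq) (Pʳ i′)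

filled≤1 : ∀ z → filled z ≤ 1
filled≤1 nothing  = z≤n
filled≤1 (just _) = s≤s z≤n

isVal-self : ∀ x → isVal x (just x) ≡ 1
isVal-self x with Maybeₚ.≡-dec ℤₚ._≟_ (just x) (just x)
... | yes _   = refl
... | no x≢x  = contradiction refl x≢x

isVal-other : ∀ x z → z ≢ just x → isVal x z ≡ 0
isVal-other x z z≢x with Maybeₚ.≡-dec ℤₚ._≟_ z (just x)
... | yes z≡x = contradiction z≡x z≢x
... | no _    = refl

filled≡posE+negE+isVal0 : ∀ z → filled z ≡ posE z + negE z + isVal 0ℤ z
filled≡posE+negE+isVal0 nothing             = refl
filled≡posE+negE+isVal0 (just (+ zero))     = refl
filled≡posE+negE+isVal0 (just (+ suc u))    = refl
filled≡posE+negE+isVal0 (just -[1+ u ])     = refl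

empty-line-sum : ∀ k (f : Fin k → Maybe ℤ) →
                 sumℕ k (λ i → filled (f i)) ≡ 0 → sumℤ k (λ i → val (f i)) ≡ 0ℤ
empty-line-sum zero    f _  = refl
empty-line-sum (suc k) f eq with f zero
... | nothing = trans (ℤₚ.+-identityˡ _) (empty-line-sum k (f ∘ suc) eq)

single-entry-line-sum : ∀ k (f : Fin k → Maybe ℤ) → sumℕ k (λ i → filled (f i)) ≡ 1 →
  Σ (Fin k) λ i → Σ ℤ λ x → f i ≡ just x × sumℤ k (λ i → val (f i)) ≡ x
single-entry-line-sum (suc k) f eq with f zero in f0
... | nothing with single-entry-line-sum k (f ∘ suc) eq
...   | i , x , fi≡x , sum≡x = suc i , x , fi≡x , trans (ℤₚ.+-identityˡ _) sum≡x
single-entry-line-sum (suc k) f eq | just x =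
  zero , x , f0 ,
  trans (cong (ℤ._+_ x) (empty-line-sum k (f ∘ suc) (ℕₚ.suc-injective eq))) (ℤₚ.+-identityʳ x)

InX-even⇒ : ∀ {N h x} → N ≡ h * 2 → InX N x → x ≢ 0ℤ × ∣ x ∣ ≤ h
InX-even⇒ {h = h} refl (x≢0 , x≤) = x≢0 (m*n%n≡0 h 2) , subst (_ ≤_) (m*n/n≡m h 2) x≤

InX-even⇐ : ∀ {N h x} → N ≡ h * 2 → x ≢ 0ℤ → ∣ x ∣ ≤ h → InX N x
InX-even⇐ {h = h} refl x≢0 x≤h = (λ _ → x≢0) , subst (_ ≤_) (sym (m*n/n≡m h 2)) x≤h

shift : ℕ → ℤ → ℤ
shift c (+ zero)  = + zero
shift c (+ suc u) = + (suc u + c)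
shift c -[1+ u ]  = -[1+ u + c ]

shiftArray : ∀ {m n} → ℕ → Array m n → Array m n
shiftArray c A i j = map (shift c) (A i j)

∣shift∣ : ∀ c w → w ≢ 0ℤ → ∣ shift c w ∣ ≡ ∣ w ∣ + c
∣shift∣ c (+ zero)  w≢0 = contradiction refl w≢0
∣shift∣ c (+ suc u) _   = refl
∣shift∣ c -[1+ u ]  _   = refl

shift-≢0 : ∀ c w → w ≢ 0ℤ → shift c w ≢ 0ℤ
shift-≢0 c (+ zero)  w≢0 = w≢0
shift-≢0 c (+ suc u) _   = λ ()
shift-≢0 c -[1+ u ]  _   = λ ()

shift-≢0⇒< : ∀ c w → shift c w ≢ 0ℤ → c < ∣ shift c w ∣
shift-≢0⇒< c (+ zero)  s≢0 = contradiction refl s≢0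
shift-≢0⇒< c (+ suc u) _   = s≤s (ℕₚ.m≤n+m c u)
shift-≢0⇒< c -[1+ u ]  _   = s≤s (ℕₚ.m≤n+m c u)

unshift : ℕ → ℤ → ℤ
unshift c (+ zero)  = + zero
unshift c (+ suc v) = + suc (v ∸ c)
unshift c -[1+ v ]  = -[1+ v ∸ c ]

unshift-shift : ∀ c w → unshift c (shift c w) ≡ w
unshift-shift c (+ zero)  = refl
unshift-shift c (+ suc u) = cong (+_ ∘ suc) (ℕₚ.m+n∸n≡m u c)
unshift-shift c -[1+ u ]  = cong -[1+_] (ℕₚ.m+n∸n≡m u c)

shift-unshift : ∀ c x → c < ∣ x ∣ → shift c (unshift c x) ≡ x
shift-unshift c (+ suc v) (s≤s c≤v) = cong (+_ ∘ suc) (ℕₚ.m∸n+n≡m c≤v)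
shift-unshift c -[1+ v ]  (s≤s c≤v) = cong -[1+_] (ℕₚ.m∸n+n≡m c≤v)

shift-injective : ∀ c {w w′} → shift c w ≡ shift c w′ → w ≡ w′
shift-injective c {w} {w′} eq =
  trans (sym (unshift-shift c w)) (trans (cong (unshift c) eq) (unshift-shift c w′))

filled-map : ∀ (f : ℤ → ℤ) z → filled (map f z) ≡ filled z
filled-map f nothing  = refl
filled-map f (just _) = refl

posE-shift : ∀ c z → posE (map (shift c) z) ≡ posE z
posE-shift c nothing           = refl
posE-shift c (just (+ zero))   = refl
posE-shift c (just (+ suc _))  = refl
posE-shift c (just -[1+ _ ])   = refl

negE-shift : ∀ c z → negE (map (shift c) z) ≡ negE z
negE-shift c nothing           = refl
negE-shift c (just (+ zero))   = refl
negE-shift c (just (+ suc _))  = refl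
negE-shift c (just -[1+ _ ])   = refl

isVal-shift : ∀ c y z → isVal (shift c y) (map (shift c) z) ≡ isVal y z
-- The `with` also abstracts the decision inside `isVal y z`, which then reduces to 1 resp. 0.
isVal-shift c y z with Maybeₚ.≡-dec ℤₚ._≟_ z (just y)
... | yes refl = isVal-self (shift c y)
... | no z≢y   = isVal-other _ _ (z≢y ∘ shifted⁻¹ z)
  where
  shifted⁻¹ : ∀ z → map (shift c) z ≡ just (shift c y) → z ≡ just y
  shifted⁻¹ (just w) eq = cong just (shift-injective c (Maybeₚ.just-injective eq))

shifted-cell-large : ∀ c z x → map (shift c) z ≡ just x → x ≢ 0ℤ → c < ∣ x ∣
shifted-cell-large c (just w) _ refl x≢0 = shift-≢0⇒< c w x≢0

val-shift : ∀ c z → val (map (shift c) z) ℤ.+ + (negE z * c) ≡ val z ℤ.+ + (posE z * c)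
val-shift c nothing          = refl
val-shift c (just (+ zero))  = refl
val-shift c (just (+ suc u)) =
  cong +_ (trans (ℕₚ.+-identityʳ _) (cong (_+_ (suc u)) (sym (ℕₚ.+-identityʳ c))))
val-shift c (just -[1+ u ])  = begin
  -[1+ u + c ] ℤ.+ + (c + 0)              ≡⟨ cong (λ t → -[1+ u + c ] ℤ.+ + t) (ℕₚ.+-identityʳ c) ⟩
  -[1+ u + c ] ℤ.+ + c                    ≡⟨ cong (ℤ._+ + c) (ℤₚ.neg-distrib-+ (+ suc u) (+ c)) ⟩
  -[1+ u ] ℤ.+ ℤ.- + c ℤ.+ + c            ≡⟨ ℤₚ.+-assoc -[1+ u ] (ℤ.- + c) (+ c) ⟩
  -[1+ u ] ℤ.+ (ℤ.- + c ℤ.+ + c)          ≡⟨ cong (ℤ._+_ -[1+ u ]) (ℤₚ.+-inverseˡ (+ c)) ⟩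
  -[1+ u ] ℤ.+ 0ℤ                         ≡⟨ ℤₚ.+-identityʳ -[1+ u ] ⟩
  -[1+ u ]                                ∎
  where open ≡-Reasoning

shifted-line-sum : ∀ c k (f : Fin k → Maybe ℤ) →
  sumℕ k (λ i → posE (f i)) ≡ sumℕ k (λ i → negE (f i)) →
  sumℤ k (λ i → val (f i)) ≡ 0ℤ →
  sumℤ k (λ i → val (map (shift c) (f i))) ≡ 0ℤ
shifted-line-sum c k f pos≡neg sum≡0 = ∙-cancelʳ (+ (count negE * c)) _ _ (begin
  sumℤ k (val ∘ f′) ℤ.+ + (count negE * c)                ≡⟨ cong (ℤ._+_ (sumℤ k (val ∘ f′))) (scaled negE) ⟩
  sumℤ k (val ∘ f′) ℤ.+ sumℤ k (λ i → + (negE (f i) * c)) ≡⟨ sumℤ-distrib-+ k _ _ ⟨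
  sumℤ k (λ i → val (f′ i) ℤ.+ + (negE (f i) * c))        ≡⟨ sumℤ-cong k (val-shift c ∘ f) ⟩
  sumℤ k (λ i → val (f i) ℤ.+ + (posE (f i) * c))         ≡⟨ sumℤ-distrib-+ k _ _ ⟩
  sumℤ k (val ∘ f) ℤ.+ sumℤ k (λ i → + (posE (f i) * c))  ≡⟨ cong₂ ℤ._+_ sum≡0 (sym (scaled posE)) ⟩
  0ℤ ℤ.+ + (count posE * c)                               ≡⟨ cong (λ t → 0ℤ ℤ.+ + (t * c)) pos≡neg ⟩
  0ℤ ℤ.+ + (count negE * c)                               ∎)
  where
  open ≡-Reasoning
  f′ : Fin k → Maybe ℤ
  f′ i = map (shift c) (f i)
  count : (Maybe ℤ → ℕ) → ℕ
  count g = sumℕ k (λ i → g (f i))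
  scaled : ∀ g → + (count g * c) ≡ sumℤ k (λ i → + (g (f i) * c))
  scaled g = trans (cong +_ (*-distribʳ-sumℕ k c (g ∘ f))) (sym (sumℤ-+ k _))

⊕-cell : ∀ {M N m n} → Array M N → Array m n → Fin M ⊎ Fin m → Fin N ⊎ Fin n → Maybe ℤ
⊕-cell P Q (inj₁ i) (inj₁ j) = P i j
⊕-cell P Q (inj₂ i) (inj₂ j) = Q i j
⊕-cell P Q (inj₁ i) (inj₂ j) = nothing
⊕-cell P Q (inj₂ i) (inj₁ j) = nothing

_⊕_ : ∀ {M N m n} → Array M N → Array m n → Array (M + m) (N + n)
(P ⊕ Q) i j = ⊕-cell P Q (splitAt _ i) (splitAt _ j)

occurrences : ∀ {m n} → ℤ → Array m n → ℕ
occurrences {m} {n} x A = sumℕ m (λ i → sumℕ n (λ j → isVal x (A i j)))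

occurrences-absent : ∀ {m n} x (A : Array m n) → (∀ i j → A i j ≢ just x) → occurrences x A ≡ 0
occurrences-absent {m} {n} x A x∉A =
  sumℕ-zero m (λ i → sumℕ-zero n (λ j → isVal-other x (A i j) (x∉A i j)))

occurrences-shift : ∀ {m n} c y (A : Array m n) →
                    occurrences (shift c y) (shiftArray c A) ≡ occurrences y A
occurrences-shift {m} {n} c y A = sumℕ-cong m (λ i → sumℕ-cong n (λ j → isVal-shift c y (A i j)))

module _ {M N m n} (P : Array M N) (Q : Array m n) where

  ⊕-↑ˡ-↑ˡ : ∀ i j → (P ⊕ Q) (i ↑ˡ m) (j ↑ˡ n) ≡ P i j
  ⊕-↑ˡ-↑ˡ i j rewrite splitAt-↑ˡ M i m | splitAt-↑ˡ N j n = refl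

  ⊕-↑ˡ-↑ʳ : ∀ i j → (P ⊕ Q) (i ↑ˡ m) (N ↑ʳ j) ≡ nothing
  ⊕-↑ˡ-↑ʳ i j rewrite splitAt-↑ˡ M i m | splitAt-↑ʳ N n j = refl

  ⊕-↑ʳ-↑ˡ : ∀ i j → (P ⊕ Q) (M ↑ʳ i) (j ↑ˡ n) ≡ nothing
  ⊕-↑ʳ-↑ˡ i j rewrite splitAt-↑ʳ M m i | splitAt-↑ˡ N j n = refl

  ⊕-↑ʳ-↑ʳ : ∀ i j → (P ⊕ Q) (M ↑ʳ i) (N ↑ʳ j) ≡ Q i j
  ⊕-↑ʳ-↑ʳ i j rewrite splitAt-↑ʳ M m i | splitAt-↑ʳ N n j = refl

  ⊕-entry : ∀ i j x → (P ⊕ Q) i j ≡ just x →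
            (Σ (Fin M) λ i′ → Σ (Fin N) λ j′ → P i′ j′ ≡ just x) ⊎
            (Σ (Fin m) λ i′ → Σ (Fin n) λ j′ → Q i′ j′ ≡ just x)
  ⊕-entry i j x eq with splitAt M i | splitAt N j
  ... | inj₁ i′ | inj₁ j′ = inj₁ (i′ , j′ , eq)
  ... | inj₂ i′ | inj₂ j′ = inj₂ (i′ , j′ , eq)

  module _ (g : Maybe ℤ → ℕ) (g-nothing : g nothing ≡ 0) where

    sumℕ-⊕-row-↑ˡ : ∀ i →
      sumℕ (N + n) (λ j → g ((P ⊕ Q) (i ↑ˡ m) j))
      ≡ sumℕ N (λ j → g (P i j))
    sumℕ-⊕-row-↑ˡ i = trans (sumℕ-↑ˡ N n _ (λ j → trans (cong g (⊕-↑ˡ-↑ʳ i j)) g-nothing))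
                            (sumℕ-cong N (λ j → cong g (⊕-↑ˡ-↑ˡ i j)))

    sumℕ-⊕-row-↑ʳ : ∀ i →
      sumℕ (N + n) (λ j → g ((P ⊕ Q) (M ↑ʳ i) j))
      ≡ sumℕ n (λ j → g (Q i j))
    sumℕ-⊕-row-↑ʳ i = trans (sumℕ-↑ʳ N n _ (λ j → trans (cong g (⊕-↑ʳ-↑ˡ i j)) g-nothing))
                            (sumℕ-cong n (λ j → cong g (⊕-↑ʳ-↑ʳ i j)))

    sumℕ-⊕-col-↑ˡ : ∀ j →
      sumℕ (M + m) (λ i → g ((P ⊕ Q) i (j ↑ˡ n)))
      ≡ sumℕ M (λ i → g (P i j))
    sumℕ-⊕-col-↑ˡ j = trans (sumℕ-↑ˡ M m _ (λ i → trans (cong g (⊕-↑ʳ-↑ˡ i j)) g-nothing))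
                            (sumℕ-cong M (λ i → cong g (⊕-↑ˡ-↑ˡ i j)))

    sumℕ-⊕-col-↑ʳ : ∀ j →
      sumℕ (M + m) (λ i → g ((P ⊕ Q) i (N ↑ʳ j)))
      ≡ sumℕ m (λ i → g (Q i j))
    sumℕ-⊕-col-↑ʳ j = trans (sumℕ-↑ʳ M m _ (λ i → trans (cong g (⊕-↑ˡ-↑ʳ i j)) g-nothing))
                            (sumℕ-cong m (λ i → cong g (⊕-↑ʳ-↑ʳ i j)))

  sumℤ-⊕-row-↑ˡ : ∀ i →
    sumℤ (N + n) (λ j → val ((P ⊕ Q) (i ↑ˡ m) j))
    ≡ sumℤ N (λ j → val (P i j))
  sumℤ-⊕-row-↑ˡ i = trans (sumℤ-↑ˡ N n _ (λ j → cong val (⊕-↑ˡ-↑ʳ i j)))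
                          (sumℤ-cong N (λ j → cong val (⊕-↑ˡ-↑ˡ i j)))

  sumℤ-⊕-row-↑ʳ : ∀ i →
    sumℤ (N + n) (λ j → val ((P ⊕ Q) (M ↑ʳ i) j))
    ≡ sumℤ n (λ j → val (Q i j))
  sumℤ-⊕-row-↑ʳ i = trans (sumℤ-↑ʳ N n _ (λ j → cong val (⊕-↑ʳ-↑ˡ i j)))
                          (sumℤ-cong n (λ j → cong val (⊕-↑ʳ-↑ʳ i j)))

  sumℤ-⊕-col-↑ˡ : ∀ j →
    sumℤ (M + m) (λ i → val ((P ⊕ Q) i (j ↑ˡ n)))
    ≡ sumℤ M (λ i → val (P i j))
  sumℤ-⊕-col-↑ˡ j = trans (sumℤ-↑ˡ M m _ (λ i → cong val (⊕-↑ʳ-↑ˡ i j)))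
                          (sumℤ-cong M (λ i → cong val (⊕-↑ˡ-↑ˡ i j)))

  sumℤ-⊕-col-↑ʳ : ∀ j →
    sumℤ (M + m) (λ i → val ((P ⊕ Q) i (N ↑ʳ j)))
    ≡ sumℤ m (λ i → val (Q i j))
  sumℤ-⊕-col-↑ʳ j = trans (sumℤ-↑ʳ M m _ (λ i → cong val (⊕-↑ˡ-↑ʳ i j)))
                          (sumℤ-cong m (λ i → cong val (⊕-↑ʳ-↑ʳ i j)))

  occurrences-⊕ : ∀ x → occurrences x (P ⊕ Q) ≡ occurrences x P + occurrences x Q
  occurrences-⊕ x = trans (sumℕ-++ M m _)
    (cong₂ _+_ (sumℕ-cong M (sumℕ-⊕-row-↑ˡ (isVal x) refl))
               (sumℕ-cong m (sumℕ-⊕-row-↑ʳ (isVal x) refl)))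

module _ {M N m n r s : ℕ} (C : SMR M N r s) (A : SMR m n r s) (A-shiftable : Shiftable A)
         (2∣Mr : 2 ∣ M * r) (2∣mr : 2 ∣ m * r) where

  private
    module C = SMR C
    module A = SMR A

    c a : ℕ
    c = quotient 2∣Mr
    a = quotient 2∣mr

    Mr≡c*2 : M * r ≡ c * 2
    Mr≡c*2 = _∣_.equality 2∣Mr

    mr≡a*2 : m * r ≡ a * 2
    mr≡a*2 = _∣_.equality 2∣mr

    [M+m]r≡[c+a]*2 : (M + m) * r ≡ (c + a) * 2
    [M+m]r≡[c+a]*2 = begin
      (M + m) * r     ≡⟨ ℕₚ.*-distribʳ-+ r M m ⟩
      M * r + m * r   ≡⟨ cong₂ _+_ Mr≡c*2 mr≡a*2 ⟩
      c * 2 + a * 2   ≡⟨ ℕₚ.*-distribʳ-+ 2 c a ⟨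
      (c + a) * 2     ∎
      where open ≡-Reasoning

    A′ : Array m n
    A′ = shiftArray c A.A

    D : Array (M + m) (N + n)
    D = C.A ⊕ A′

    module _ (g : Maybe ℤ → ℕ) (g-nothing : g nothing ≡ 0)
             (g-shift : ∀ z → g (map (shift c) z) ≡ g z) where

      sum-row-↑ʳ : ∀ i → sumℕ (N + n) (λ j → g (D (M ↑ʳ i) j)) ≡ sumℕ n (λ j → g (A.A i j))
      sum-row-↑ʳ i = trans (sumℕ-⊕-row-↑ʳ C.A A′ g g-nothing i) (sumℕ-cong n (λ j → g-shift (A.A i j)))

      sum-col-↑ʳ : ∀ j → sumℕ (M + m) (λ i → g (D i (N ↑ʳ j))) ≡ sumℕ m (λ i → g (A.A i j))
      sum-col-↑ʳ j = trans (sumℕ-⊕-col-↑ʳ C.A A′ g g-nothing j) (sumℕ-cong m (λ i → g-shift (A.A i j)))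

    entry-C : ∀ {i j x} → C.A i j ≡ just x → x ≢ 0ℤ × ∣ x ∣ ≤ c
    entry-C eq = InX-even⇒ Mr≡c*2 (C.entriesInX _ _ _ eq)

    entry-A : ∀ {i j x} → A.A i j ≡ just x → x ≢ 0ℤ × ∣ x ∣ ≤ a
    entry-A eq = InX-even⇒ mr≡a*2 (A.entriesInX _ _ _ eq)

    entriesInX : ∀ i j x → D i j ≡ just x → InX ((M + m) * r) x
    entriesInX i j x eq with ⊕-entry C.A A′ i j x eq
    ... | inj₁ (_ , _ , eqC) =
      InX-even⇐ [M+m]r≡[c+a]*2 (proj₁ (entry-C eqC)) (ℕₚ.≤-trans (proj₂ (entry-C eqC)) (ℕₚ.m≤m+n c a))
    ... | inj₂ (i′ , j′ , eqA′) with A.A i′ j′ in eqA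
    ... | just w with refl ← eqA′ =
      InX-even⇐ [M+m]r≡[c+a]*2 (shift-≢0 c w w≢0)
        (subst₂ _≤_ (sym (∣shift∣ c w w≢0)) (ℕₚ.+-comm a c) (ℕₚ.+-monoˡ-≤ c w≤a))
      where
      w≢0 : w ≢ 0ℤ
      w≢0 = proj₁ (entry-A eqA)
      w≤a : ∣ w ∣ ≤ a
      w≤a = proj₂ (entry-A eqA)

    eachOnce : ∀ x → InX ((M + m) * r) x → occurrences x D ≡ 1
    eachOnce x x∈X with InX-even⇒ [M+m]r≡[c+a]*2 x∈X
    ... | x≢0 , x≤c+a with ∣ x ∣ ℕₚ.≤? c
    ... | yes x≤c = begin
      occurrences x D                           ≡⟨ occurrences-⊕ C.A A′ x ⟩
      occurrences x C.A + occurrences x A′      ≡⟨ cong₂ _+_ (C.eachOnce x (InX-even⇐ Mr≡c*2 x≢0 x≤c))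
                                                              (occurrences-absent x A′ x∉A′) ⟩
      1 + 0                                     ∎
      where
      open ≡-Reasoning
      x∉A′ : ∀ i j → A′ i j ≢ just x
      x∉A′ i j eq = ℕₚ.<⇒≱ (shifted-cell-large c (A.A i j) x eq x≢0) x≤c
    ... | no x≰c with unshift c x | shift-unshift c x (ℕₚ.≰⇒> x≰c)
    ... | y | refl = begin
      occurrences x D                          ≡⟨ occurrences-⊕ C.A A′ x ⟩
      occurrences x C.A + occurrences x A′     ≡⟨ cong₂ _+_ (occurrences-absent x C.A x∉C)
                                                             (occurrences-shift c y A.A) ⟩
      0 + occurrences y A.A                    ≡⟨ A.eachOnce y (InX-even⇐ mr≡a*2 y≢0 y≤a) ⟩
      1                                        ∎
      where
      open ≡-Reasoning
      x∉C : ∀ i j → C.A i j ≢ just x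
      x∉C i j eq = x≰c (proj₂ (entry-C eq))
      y≢0 : y ≢ 0ℤ
      y≢0 refl = x≢0 refl
      y≤a : ∣ y ∣ ≤ a
      y≤a = ℕₚ.+-cancelʳ-≤ c ∣ y ∣ a (subst₂ _≤_ (∣shift∣ c y y≢0) (ℕₚ.+-comm c a) x≤c+a)

  ⊕-shifted : SMR (M + m) (N + n) r s
  ⊕-shifted = record
    { A          = D
    ; rowFilled  = ↑-elim _
        (λ i → trans (sumℕ-⊕-row-↑ˡ C.A A′ filled refl i) (C.rowFilled i))
        (λ i → trans (sum-row-↑ʳ filled refl (filled-map (shift c)) i) (A.rowFilled i))
    ; colFilled  = ↑-elim _
        (λ j → trans (sumℕ-⊕-col-↑ˡ C.A A′ filled refl j) (C.colFilled j))
        (λ j → trans (sum-col-↑ʳ filled refl (filled-map (shift c)) j) (A.colFilled j))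
    ; entriesInX = entriesInX
    ; eachOnce   = eachOnce
    ; rowSum     = ↑-elim _
        (λ i → trans (sumℤ-⊕-row-↑ˡ C.A A′ i) (C.rowSum i))
        (λ i → trans (sumℤ-⊕-row-↑ʳ C.A A′ i)
                     (shifted-line-sum c n (A.A i) (proj₁ A-shiftable i) (A.rowSum i)))
    ; colSum     = ↑-elim _
        (λ j → trans (sumℤ-⊕-col-↑ˡ C.A A′ j) (C.colSum j))
        (λ j → trans (sumℤ-⊕-col-↑ʳ C.A A′ j)
                     (shifted-line-sum c m (λ i → A.A i j) (proj₂ A-shiftable j) (A.colSum j)))
    }

  ⊕-shifted-shiftable : Shiftable C → Shiftable ⊕-shifted
  ⊕-shifted-shiftable (C-rows , C-cols) =
    ↑-elim _
      (λ i → trans (sumℕ-⊕-row-↑ˡ C.A A′ posE refl i)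
               (trans (C-rows i) (sym (sumℕ-⊕-row-↑ˡ C.A A′ negE refl i))))
      (λ i → trans (sum-row-↑ʳ posE refl (posE-shift c) i)
               (trans (proj₁ A-shiftable i) (sym (sum-row-↑ʳ negE refl (negE-shift c) i)))) ,
    ↑-elim _
      (λ j → trans (sumℕ-⊕-col-↑ˡ C.A A′ posE refl j)
               (trans (C-cols j) (sym (sumℕ-⊕-col-↑ˡ C.A A′ negE refl j))))
      (λ j → trans (sum-col-↑ʳ posE refl (posE-shift c) j)
               (trans (proj₂ A-shiftable j) (sym (sum-col-↑ʳ negE refl (negE-shift c) j))))

shiftable-line-has-zero : ∀ {r} k (f : Fin k → Maybe ℤ) → ¬ 2 ∣ r →
  sumℕ k (λ i → filled (f i)) ≡ r →
  sumℕ k (λ i → posE (f i)) ≡ sumℕ k (λ i → negE (f i)) →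
  1 ≤ sumℕ k (λ i → isVal 0ℤ (f i))
shiftable-line-has-zero {r} k f 2∤r filled≡r pos≡neg =
  ℕₚ.n≢0⇒n>0 λ zeros≡0 → 2∤r (divides (count negE) (begin
  r                                                  ≡⟨ filled≡r ⟨
  sumℕ k (λ i → filled (f i))                        ≡⟨ sumℕ-cong k (filled≡posE+negE+isVal0 ∘ f) ⟩
  sumℕ k (λ i → posE (f i) + negE (f i) + isVal 0ℤ (f i))
                                                     ≡⟨ sumℕ-distrib-+ k _ _ ⟩
  sumℕ k (λ i → posE (f i) + negE (f i)) + count (isVal 0ℤ)
                                                     ≡⟨ cong₂ _+_ (sumℕ-distrib-+ k _ _) zeros≡0 ⟩
  count posE + count negE + 0                        ≡⟨ cong (λ p → p + count negE + 0) pos≡neg ⟩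
  count negE + count negE + 0                        ≡⟨ ℕₚ.+-assoc (count negE) (count negE) 0 ⟩
  count negE + (count negE + 0)                      ≡⟨ ℕₚ.*-comm 2 (count negE) ⟩
  count negE * 2                                     ∎))
  where
  open ≡-Reasoning
  count : (Maybe ℤ → ℕ) → ℕ
  count g = sumℕ k (λ i → g (f i))

odd-shiftable⇒s≤1 : ∀ {m n r s} → ¬ 2 ∣ m * r → 1 ≤ n → (A : SMR m n r s) → Shiftable A → s ≤ 1
odd-shiftable⇒s≤1 {m} {n} {r} {s} 2∤mr 1≤n A (rows-balanced , _) = begin
  s                                   ≡⟨ A.colFilled j ⟨
  sumℕ m (λ i → filled (A.A i j))     ≤⟨ sumℕ≤length m _ (λ i → filled≤1 (A.A i j)) ⟩
  m                                   ≤⟨ length≤sumℕ m _ row-has-zero ⟩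
  occurrences 0ℤ A.A                  ≡⟨ A.eachOnce 0ℤ 0∈X ⟩
  1                                   ∎
  where
  module A = SMR A
  open ℕₚ.≤-Reasoning
  j : Fin n
  j = fromℕ< 1≤n
  0∈X : InX (m * r) 0ℤ
  0∈X = (λ mr%2≡0 _ → 2∤mr (m%n≡0⇒n∣m (m * r) 2 mr%2≡0)) , z≤n
  row-has-zero : ∀ i → 1 ≤ sumℕ n (λ j → isVal 0ℤ (A.A i j))
  row-has-zero i =
    shiftable-line-has-zero n (A.A i) (2∤mr ∘ ∣n⇒∣m*n m) (A.rowFilled i) (rows-balanced i)

even-SMR⇒s≢1 : ∀ {m n r} → 2 ∣ m * r → 1 ≤ n → ¬ SMR m n r 1
even-SMR⇒s≢1 {m} {n} {r} 2∣mr 1≤n A =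
  let i , x , A[i,j]≡x , sum≡x = single-entry-line-sum m (λ i → A.A i j) (A.colFilled j)
  in proj₁ (A.entriesInX i j x A[i,j]≡x) (n∣m⇒m%n≡0 (m * r) 2 2∣mr)
           (trans (sym sum≡x) (A.colSum j))
  where
  module A = SMR A
  j : Fin n
  j = fromℕ< 1≤n

module _ {m n m′ n′ r s : ℕ} (A : SMR m n r s) (A-shiftable : Shiftable A) (B : SMR m′ n′ r s)
         (2∣mr : 2 ∣ m * r) (2∣m′r : 2 ∣ m′ * r) where

  2∣[tm+m′]r : ∀ t → 2 ∣ (t * m + m′) * r
  2∣[tm+m′]r t = subst (2 ∣_) (sym [tm+m′]r≡t[mr]+m′r) (∣m∣n⇒∣m+n (∣n⇒∣m*n t 2∣mr) 2∣m′r)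
    where
    [tm+m′]r≡t[mr]+m′r : (t * m + m′) * r ≡ t * (m * r) + m′ * r
    [tm+m′]r≡t[mr]+m′r =
      trans (ℕₚ.*-distribʳ-+ r (t * m) m′) (cong (_+ m′ * r) (ℕₚ.*-assoc t m r))

  iterate-⊕-shifted : ∀ t → Σ (SMR (t * m + m′) (t * n + n′) r s) λ D → Shiftable B → Shiftable D
  iterate-⊕-shifted zero    = B , id
  iterate-⊕-shifted (suc t) with iterate-⊕-shifted t
  ... | D , D-shiftable =
    subst₂ (λ u v → Σ (SMR u v r s) λ E → Shiftable B → Shiftable E)
           (rotate (t * m) m′ m) (rotate (t * n) n′ n)
      (⊕-shifted D A A-shiftable (2∣[tm+m′]r t) 2∣mr ,
       ⊕-shifted-shiftable D A A-shiftable (2∣[tm+m′]r t) 2∣mr ∘ D-shiftable)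
    where
    rotate : ∀ x y z → x + y + z ≡ z + x + y
    rotate x y z = trans (ℕₚ.+-comm (x + y) z) (sym (ℕₚ.+-assoc z x y))

theorem7 : (m n m′ n′ r s : ℕ) →
    1 ≤ m → 1 ≤ n → 1 ≤ m′ → 1 ≤ n′ → 1 ≤ r → 1 ≤ s →
    2 ∣ m′ * r →
    Σ (SMR m n r s) Shiftable →
    (B : SMR m′ n′ r s) →
    (k : ℕ) → 1 ≤ k →
    SMR (k * m + m′) (k * n + n′) r s ×
    (Shiftable B → Σ (SMR (k * m + m′) (k * n + n′) r s) Shiftable)
theorem7 m n m′ n′ r s _ 1≤n _ 1≤n′ _ 1≤s 2∣m′r (A , A-shiftable) B k _ with 2 ∣? m * r
... | no 2∤mr =
  contradiction (subst (SMR m′ n′ r) s≡1 B) (even-SMR⇒s≢1 2∣m′r 1≤n′)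
  where
  s≡1 : s ≡ 1
  s≡1 = ℕₚ.≤-antisym (odd-shiftable⇒s≤1 2∤mr 1≤n A A-shiftable) 1≤s
... | yes 2∣mr = proj₁ Dₖ , λ B-shiftable → proj₁ Dₖ , proj₂ Dₖ B-shiftable
  where
  Dₖ : Σ (SMR (k * m + m′) (k * n + n′) r s) λ D → Shiftable B → Shiftable D
  Dₖ = iterate-⊕-shifted A A-shiftable B 2∣mr 2∣m′r k
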